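{- Let $1<k\in\mathbb{Z}$ and $1\le i\le k$, and let $N=\binom{k-1}{i-1}$. Let $A(1),\dots,A(N)$ be the compositions $(a_1,\dots,a_i)$ of $k+1$ into $i$ positive parts with $a_1\ge 2$, and let $B(1),\dots,B(N)$ be the compositions $(b_1,\dots,b_i)$ of $k$ into $i$ positive parts, each list in descending lexicographic order. For $1\le p,q\le N$, with $A(p)=(a_1(p),\dots,a_i(p))$ and $B(q)=(b_1(q),\dots,b_i(q))$, set $t^k_i(p,q)=1$ if $\sum_{j=1}^{h}\bigl(a_j(p)-b_j(q)\bigr)>0$ for every $h=1,\dots,i$, and $t^k_i(p,q)=0$ otherwise. Let $\mu(A(p),B(q))=0^{a_1(p)}1^{b_1(q)}0^{a_2(p)}1^{b_2(q)}\cdots 0^{a_i(p)}1^{b_i(q)}$, a binary string of length $2k+1$ (here $0^m$ denotes $m$ consecutive zeros and $1^m$ denotes $m$ consecutive ones). Then $t^k_i(p,q)=1$ if and only if $\mu(A(p),B(q))$ represents an ordered $k$-edge tree, i.e. $\mu(A(p),B(q))=0\,w$ where $w$ is the depth-first encoding of some ordered (finite, plane, rooted) tree with $k$ edges.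
   Context: A composition of a positive integer $n$ into $i$ parts is an ordered $i$-tuple of positive integers with sum $n$. An ordered tree is a finite rooted plane tree (children of each vertex linearly ordered). The depth-first (preorder) encoding of an ordered tree with $k$ edges is the binary word of length $2k$ obtained by traversing the tree in preorder from the root, writing $0$ each time one goes down an edge away from the root and $1$ each time one goes up an edge toward the root. -}

module Defs where

open import Data.Nat using (ℕ; zero; suc; _+_; _≤_; _<_)
open import Data.Integer as ℤ using (ℤ; +_; _-_)
open import Data.Nat.ListAction using (sum)
open import Data.List using (List; []; _∷_; _++_; [_]; length; take; zipWith; replicate; concat)
open import Data.List.Relation.Unary.All using (All)
open import Data.Product using (_×_; Σ)
open import Data.Empty using (⊥)
open import Relation.Binary.PropositionalEquality using (_≡_)

IsComposition : ℕ → ℕ → List ℕ → Set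
IsComposition n i xs = (length xs ≡ i) × (All (λ x → 0 < x) xs × (sum xs ≡ n))

FirstPartAtLeast2 : List ℕ → Set
FirstPartAtLeast2 []      = ⊥
FirstPartAtLeast2 (x ∷ _) = 2 ≤ x

sumℤ : List ℤ → ℤ
sumℤ []       = ℤ.0ℤ
sumℤ (x ∷ xs) = x ℤ.+ sumℤ xs

TOne : ℕ → List ℕ → List ℕ → Set
TOne i as bs = (h : ℕ) → 1 ≤ h → h ≤ i →
  ℤ.0ℤ ℤ.< sumℤ (take h (zipWith (λ a b → + a - + b) as bs))

data Bit : Set where
  b0 b1 : Bit

μ : List ℕ → List ℕ → List Bit
μ as bs = concat (zipWith (λ a b → replicate a b0 ++ replicate b b1) as bs)

data Tree : Set where
  node : List Tree → Tree

mutual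
  edges : Tree → ℕ
  edges (node ts) = edgesF ts

  edgesF : List Tree → ℕ
  edgesF []       = 0
  edgesF (t ∷ ts) = suc (edges t) + edgesF ts

mutual
  dfs : Tree → List Bit
  dfs (node ts) = dfsF ts

  dfsF : List Tree → List Bit
  dfsF []       = []
  dfsF (t ∷ ts) = (b0 ∷ dfs t ++ [ b1 ]) ++ dfsF ts

RepresentsTree : ℕ → List Bit → Set
RepresentsTree k s = Σ Tree (λ T → (edges T ≡ k) × (s ≡ b0 ∷ dfs T))

-- Read 0 as a step up and 1 as a step down. A binary word is the depth-first code of an
-- ordered forest exactly when its path from height 0 never goes below 0 and ends at 0, and
-- 0 w codes a k-edge tree exactly when w codes a forest with k edges. Write A = (a₁, …, aᵢ)
-- and w = μ((a₁ − 1, a₂, …, aᵢ), B), so that μ(A, B) = 0 w. The path of w can only reach a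
-- new minimum at the end of a block of ones, where its height is the partial sum
-- Σ_{j ≤ h} (a_j − b_j) − 1; so it stays nonnegative iff all these partial sums are
-- positive, and then it ends at height 0 because (a₁ − 1) + a₂ + ⋯ + aᵢ = k = b₁ + ⋯ + bᵢ.
module Submission where

open import Defs
open import Data.Nat using (ℕ; suc; _≤_; _<_)
open import Data.List using (List)
open import Function.Bundles using (_⇔_)

open import Data.Nat using (zero; _+_; _∸_; _⊓_; z≤n; s≤s; _≤?_)
import Data.Nat.Properties as ℕₚ
open import Data.Nat.ListAction using (sum)
open import Data.Integer as ℤ using (ℤ; +_; _⊖_; 0ℤ)
import Data.Integer.Properties as ℤₚ
open import Data.List using ([]; _∷_; _++_; [_]; length; take; zipWith; replicate)
open import Data.List.Properties using (++-assoc; ++-identityʳ; ∷-injectiveʳ; length-zipWith)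
open import Data.Vec using (Vec; []; _∷_)
open import Data.Maybe using (Maybe; just; nothing)
open import Data.Product using (_×_; _,_; Σ; ∃)
open import Data.Unit using (⊤; tt)
open import Function.Bundles using (mk⇔; Equivalence)
open import Function.Properties.Equivalence using (⇔-setoid)
open import Level using (0ℓ)
open import Relation.Nullary using (yes; no; contradiction)
open import Relation.Binary.PropositionalEquality using (_≡_; refl; sym; trans; cong; cong₂; subst; module ≡-Reasoning)
open import Relation.Binary.Reasoning.Setoid (⇔-setoid 0ℓ) as ⇔-Reasoning using ()

height : ℕ → List Bit → Maybe ℕ
height n       []       = just n
height n       (b0 ∷ s) = height (suc n) s
height zero    (b1 ∷ s) = nothing
height (suc n) (b1 ∷ s) = height n s

zeros : List Bit → ℕ
zeros []       = 0
zeros (b0 ∷ s) = suc (zeros s)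
zeros (b1 ∷ s) = zeros s

ones : List Bit → ℕ
ones []       = 0
ones (b0 ∷ s) = ones s
ones (b1 ∷ s) = suc (ones s)

zeros-++ : ∀ s r → zeros (s ++ r) ≡ zeros s + zeros r
zeros-++ []       r = refl
zeros-++ (b0 ∷ s) r = cong suc (zeros-++ s r)
zeros-++ (b1 ∷ s) r = zeros-++ s r

ones-++ : ∀ s r → ones (s ++ r) ≡ ones s + ones r
ones-++ []       r = refl
ones-++ (b0 ∷ s) r = ones-++ s r
ones-++ (b1 ∷ s) r = cong suc (ones-++ s r)

height-conserves : ∀ s n {m} → height n s ≡ just m → m + ones s ≡ n + zeros s
height-conserves []       n       refl = refl
height-conserves (b0 ∷ s) n       h    = trans (height-conserves s (suc n) h) (sym (ℕₚ.+-suc n _))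
height-conserves (b1 ∷ s) (suc n) {m} h =
  trans (ℕₚ.+-suc m (ones s)) (cong suc (height-conserves s n h))

balanced-height≡just0 : ∀ s → zeros s ≡ ones s →
  (∃ λ m → height 0 s ≡ just m) ⇔ height 0 s ≡ just 0
balanced-height≡just0 s balanced = mk⇔ to (λ h → 0 , h)
  where
  to : (∃ λ m → height 0 s ≡ just m) → height 0 s ≡ just 0
  to (m , h) = trans h (cong just (ℕₚ.+-cancelʳ-≡ (ones s) m 0
                 (trans (height-conserves s 0 h) balanced)))

dfsF-node-∷ : ∀ f g r → dfsF (node f ∷ g) ++ r ≡ b0 ∷ dfsF f ++ b1 ∷ dfsF g ++ r
dfsF-node-∷ f g r = begin
  ((b0 ∷ dfsF f ++ [ b1 ]) ++ dfsF g) ++ r  ≡⟨ ++-assoc (b0 ∷ dfsF f ++ [ b1 ]) (dfsF g) r ⟩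
  b0 ∷ (dfsF f ++ [ b1 ]) ++ dfsF g ++ r    ≡⟨ cong (b0 ∷_) (++-assoc (dfsF f) [ b1 ] _) ⟩
  b0 ∷ dfsF f ++ b1 ∷ dfsF g ++ r           ∎
  where open ≡-Reasoning

zeros-dfsF : ∀ ts → zeros (dfsF ts) ≡ edgesF ts
zeros-dfsF []             = refl
zeros-dfsF (node f ∷ g) = begin
  zeros (dfsF (node f ∷ g))
    ≡⟨ cong zeros (sym (++-identityʳ (dfsF (node f ∷ g)))) ⟩
  zeros (dfsF (node f ∷ g) ++ [])
    ≡⟨ cong zeros (dfsF-node-∷ f g []) ⟩
  suc (zeros (dfsF f ++ b1 ∷ dfsF g ++ []))
    ≡⟨ cong suc (zeros-++ (dfsF f) _) ⟩
  suc (zeros (dfsF f) + zeros (dfsF g ++ []))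
    ≡⟨ cong (λ s → suc (zeros (dfsF f) + zeros s)) (++-identityʳ (dfsF g)) ⟩
  suc (zeros (dfsF f) + zeros (dfsF g))
    ≡⟨ cong₂ (λ x y → suc (x + y)) (zeros-dfsF f) (zeros-dfsF g) ⟩
  suc (edgesF f + edgesF g)
    ∎
  where open ≡-Reasoning

height-dfsF-++ : ∀ ts n r → height n (dfsF ts ++ r) ≡ height n r
height-dfsF-++ []             n r = refl
height-dfsF-++ (node f ∷ g) n r = begin
  height n (dfsF (node f ∷ g) ++ r)             ≡⟨ cong (height n) (dfsF-node-∷ f g r) ⟩
  height (suc n) (dfsF f ++ b1 ∷ dfsF g ++ r)   ≡⟨ height-dfsF-++ f (suc n) _ ⟩
  height n (dfsF g ++ r)                        ≡⟨ height-dfsF-++ g n r ⟩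
  height n r                                    ∎
  where open ≡-Reasoning

closingUps : ∀ {n} → Vec (List Tree) n → List Bit
closingUps []       = []
closingUps (f ∷ fs) = b1 ∷ dfsF f ++ closingUps fs

height≡just0⇒dfsF-++-closingUps : ∀ n s → height n s ≡ just 0 →
  Σ (List Tree) λ f → Σ (Vec (List Tree) n) λ fs → s ≡ dfsF f ++ closingUps fs
height≡just0⇒dfsF-++-closingUps zero    []       refl = [] , [] , refl
height≡just0⇒dfsF-++-closingUps (suc n) []       ()
height≡just0⇒dfsF-++-closingUps n       (b0 ∷ s) h
  with height≡just0⇒dfsF-++-closingUps (suc n) s h
... | f , g ∷ fs , refl = node f ∷ g , fs , sym (dfsF-node-∷ f g (closingUps fs))
height≡just0⇒dfsF-++-closingUps (suc n) (b1 ∷ s) h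
  with height≡just0⇒dfsF-++-closingUps n s h
... | f , fs , refl = [] , f ∷ fs , refl

height≡just0⇔dfsF : ∀ s → height 0 s ≡ just 0 ⇔ (∃ λ ts → s ≡ dfsF ts)
height≡just0⇔dfsF s = mk⇔ to from
  where
  to : height 0 s ≡ just 0 → ∃ λ ts → s ≡ dfsF ts
  to h with height≡just0⇒dfsF-++-closingUps 0 s h
  ... | f , [] , eq = f , trans eq (++-identityʳ (dfsF f))
  from : (∃ λ ts → s ≡ dfsF ts) → height 0 s ≡ just 0
  from (ts , refl) = trans (cong (height 0) (sym (++-identityʳ (dfsF ts)))) (height-dfsF-++ ts 0 [])

representsTree⇔dfsF : ∀ {k} w → zeros w ≡ k → RepresentsTree k (b0 ∷ w) ⇔ (∃ λ ts → w ≡ dfsF ts)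
representsTree⇔dfsF w zeros≡k = mk⇔ to from
  where
  to : RepresentsTree _ (b0 ∷ w) → ∃ λ ts → w ≡ dfsF ts
  to (node ts , _ , eq) = ts , ∷-injectiveʳ eq
  from : (∃ λ ts → w ≡ dfsF ts) → RepresentsTree _ (b0 ∷ w)
  from (ts , refl) = node ts , trans (sym (zeros-dfsF ts)) zeros≡k , refl

zeros-μ : ∀ as bs → length as ≡ length bs → zeros (μ as bs) ≡ sum as
zeros-μ []       []       _   = refl
zeros-μ (a ∷ as) (b ∷ bs) len = begin
  zeros ((replicate a b0 ++ replicate b b1) ++ μ as bs)
    ≡⟨ zeros-++ (replicate a b0 ++ replicate b b1) _ ⟩
  zeros (replicate a b0 ++ replicate b b1) + zeros (μ as bs)
    ≡⟨ cong₂ _+_ (zeros-++ (replicate a b0) _) (zeros-μ as bs (ℕₚ.suc-injective len)) ⟩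
  zeros (replicate a b0) + zeros (replicate b b1) + sum as
    ≡⟨ cong₂ (λ x y → x + y + sum as) (zeros-replicate-b0 a) (zeros-replicate-b1 b) ⟩
  a + 0 + sum as
    ≡⟨ cong (_+ sum as) (ℕₚ.+-identityʳ a) ⟩
  a + sum as
    ∎
  where
  open ≡-Reasoning
  zeros-replicate-b0 : ∀ a → zeros (replicate a b0) ≡ a
  zeros-replicate-b0 zero    = refl
  zeros-replicate-b0 (suc a) = cong suc (zeros-replicate-b0 a)
  zeros-replicate-b1 : ∀ b → zeros (replicate b b1) ≡ 0
  zeros-replicate-b1 zero    = refl
  zeros-replicate-b1 (suc b) = zeros-replicate-b1 b

ones-μ : ∀ as bs → length as ≡ length bs → ones (μ as bs) ≡ sum bs
ones-μ []       []       _   = refl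
ones-μ (a ∷ as) (b ∷ bs) len = begin
  ones ((replicate a b0 ++ replicate b b1) ++ μ as bs)
    ≡⟨ ones-++ (replicate a b0 ++ replicate b b1) _ ⟩
  ones (replicate a b0 ++ replicate b b1) + ones (μ as bs)
    ≡⟨ cong₂ _+_ (ones-++ (replicate a b0) _) (ones-μ as bs (ℕₚ.suc-injective len)) ⟩
  ones (replicate a b0) + ones (replicate b b1) + sum bs
    ≡⟨ cong₂ (λ x y → x + y + sum bs) (ones-replicate-b0 a) (ones-replicate-b1 b) ⟩
  b + sum bs
    ∎
  where
  open ≡-Reasoning
  ones-replicate-b0 : ∀ a → ones (replicate a b0) ≡ 0
  ones-replicate-b0 zero    = refl
  ones-replicate-b0 (suc a) = ones-replicate-b0 a
  ones-replicate-b1 : ∀ b → ones (replicate b b1) ≡ b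
  ones-replicate-b1 zero    = refl
  ones-replicate-b1 (suc b) = cong suc (ones-replicate-b1 b)

height-replicate-b0-++ : ∀ a n r → height n (replicate a b0 ++ r) ≡ height (n + a) r
height-replicate-b0-++ zero    n r = cong (λ x → height x r) (sym (ℕₚ.+-identityʳ n))
height-replicate-b0-++ (suc a) n r =
  trans (height-replicate-b0-++ a (suc n) r) (cong (λ x → height x r) (sym (ℕₚ.+-suc n a)))

height-replicate-b1-++ : ∀ b n r → b ≤ n → height n (replicate b b1 ++ r) ≡ height (n ∸ b) r
height-replicate-b1-++ zero    n       r _         = refl
height-replicate-b1-++ (suc b) (suc n) r (s≤s b≤n) = height-replicate-b1-++ b n r b≤n

height-replicate-b1-++-nothing : ∀ b n r → n < b → height n (replicate b b1 ++ r) ≡ nothing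
height-replicate-b1-++-nothing (suc b) zero    r _         = refl
height-replicate-b1-++-nothing (suc b) (suc n) r (s≤s n<b) = height-replicate-b1-++-nothing b n r n<b

height-μ-∷ : ∀ n a b as bs →
  height n (μ (a ∷ as) (b ∷ bs)) ≡ height (n + a) (replicate b b1 ++ μ as bs)
height-μ-∷ n a b as bs =
  trans (cong (height n) (++-assoc (replicate a b0) (replicate b b1) (μ as bs)))
        (height-replicate-b0-++ a n _)

Fits : ℕ → List ℕ → List ℕ → Set
Fits n (a ∷ as) (b ∷ bs) = b ≤ n + a × Fits (n + a ∸ b) as bs
Fits n _        _        = ⊤

fits⇔height-μ≡just : ∀ n as bs → Fits n as bs ⇔ (∃ λ m → height n (μ as bs) ≡ just m)
fits⇔height-μ≡just n as bs = mk⇔ (to n as bs) (from n as bs)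
  where
  to : ∀ n as bs → Fits n as bs → ∃ λ m → height n (μ as bs) ≡ just m
  to n []       bs       _            = n , refl
  to n (a ∷ as) []       _            = n , refl
  to n (a ∷ as) (b ∷ bs) (b≤ , fits) with to (n + a ∸ b) as bs fits
  ... | m , h = m , trans (height-μ-∷ n a b as bs) (trans (height-replicate-b1-++ b (n + a) _ b≤) h)
  from : ∀ n as bs → (∃ λ m → height n (μ as bs) ≡ just m) → Fits n as bs
  from n []       bs       _       = tt
  from n (a ∷ as) []       _       = tt
  from n (a ∷ as) (b ∷ bs) (m , h) with b ≤? n + a
  ... | yes b≤ = b≤ , from (n + a ∸ b) as bs
                        (m , trans (sym (height-replicate-b1-++ b (n + a) _ b≤))
                                   (trans (sym (height-μ-∷ n a b as bs)) h))
  ... | no b≰ with trans (sym (height-replicate-b1-++-nothing b (n + a) (μ as bs) (ℕₚ.≰⇒> b≰)))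
                         (trans (sym (height-μ-∷ n a b as bs)) h)
  ...   | ()

StaysPositive : ℤ → List ℤ → Set
StaysPositive z []       = ⊤
StaysPositive z (x ∷ xs) = 0ℤ ℤ.< z ℤ.+ x × StaysPositive (z ℤ.+ x) xs

PositivePrefixSums : ℤ → List ℤ → Set
PositivePrefixSums z xs = ∀ h → 1 ≤ h → h ≤ length xs → 0ℤ ℤ.< z ℤ.+ sumℤ (take h xs)

positivePrefixSums⇔staysPositive : ∀ z xs → PositivePrefixSums z xs ⇔ StaysPositive z xs
positivePrefixSums⇔staysPositive z xs = mk⇔ (to z xs) (from z xs)
  where
  to : ∀ z xs → PositivePrefixSums z xs → StaysPositive z xs
  to z []       _   = tt
  to z (x ∷ xs) pos =
    subst (λ y → 0ℤ ℤ.< z ℤ.+ y) (ℤₚ.+-identityʳ x) (pos 1 (s≤s z≤n) (s≤s z≤n)) ,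
    to (z ℤ.+ x) xs λ { (suc h) _ h≤ →
      subst (0ℤ ℤ.<_) (sym (ℤₚ.+-assoc z x _)) (pos (suc (suc h)) (s≤s z≤n) (s≤s h≤)) }
  from : ∀ z xs → StaysPositive z xs → PositivePrefixSums z xs
  from z (x ∷ xs) (pos , _)    (suc zero)    _ _ =
    subst (λ y → 0ℤ ℤ.< z ℤ.+ y) (sym (ℤₚ.+-identityʳ x)) pos
  from z (x ∷ xs) (_ , stays) (suc (suc h)) _ (s≤s h≤) =
    subst (0ℤ ℤ.<_) (ℤₚ.+-assoc z x _) (from (z ℤ.+ x) xs stays (suc h) (s≤s z≤n) h≤)

differences : List ℕ → List ℕ → List ℤ
differences as bs = zipWith (λ a b → + a ℤ.- + b) as bs

tOne⇔staysPositive : ∀ i as bs → length (differences as bs) ≡ i →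
  TOne i as bs ⇔ StaysPositive 0ℤ (differences as bs)
tOne⇔staysPositive i as bs refl = mk⇔
  (λ t → Equivalence.to (positivePrefixSums⇔staysPositive 0ℤ ds) λ h p q →
     subst (0ℤ ℤ.<_) (sym (ℤₚ.+-identityˡ _)) (t h p q))
  (λ s h p q →
     subst (0ℤ ℤ.<_) (ℤₚ.+-identityˡ _) (Equivalence.from (positivePrefixSums⇔staysPositive 0ℤ ds) s h p q))
  where
  ds = differences as bs

+-⊖ : ∀ n a b → + n ℤ.+ (+ a ℤ.- + b) ≡ (n + a) ⊖ b
+-⊖ n a b = trans (sym (ℤₚ.+-assoc (+ n) (+ a) (ℤ.- + b))) (ℤₚ.m-n≡m⊖n (n + a) b)

0<[1+m]⊖n⇒n≤m : ∀ m n → 0ℤ ℤ.< suc m ⊖ n → n ≤ m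
0<[1+m]⊖n⇒n≤m m n pos with n ≤? m
... | yes n≤m = n≤m
... | no  n≰m = contradiction (subst (0ℤ ℤ.<_) (ℤₚ.⊖-≤ (ℕₚ.≰⇒> n≰m)) pos)
                              (ℤₚ.≤⇒≯ (ℤₚ.neg-≤-pos {n ∸ suc m} {0}))

[1+m]⊖n≡+[1+m∸n] : ∀ m n → n ≤ m → suc m ⊖ n ≡ + suc (m ∸ n)
[1+m]⊖n≡+[1+m∸n] m n n≤m = trans (ℤₚ.⊖-≥ (ℕₚ.m≤n⇒m≤1+n n≤m)) (cong +_ (ℕₚ.+-∸-assoc 1 n≤m))

staysPositive⇔fits : ∀ n as bs → StaysPositive (+ suc n) (differences as bs) ⇔ Fits n as bs
staysPositive⇔fits n as bs = mk⇔ (to n as bs) (from n as bs)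
  where
  to : ∀ n as bs → StaysPositive (+ suc n) (differences as bs) → Fits n as bs
  to n []       bs       _            = tt
  to n (a ∷ as) []       _            = tt
  to n (a ∷ as) (b ∷ bs) (pos , stays) =
    b≤ , to (n + a ∸ b) as bs
           (subst (λ z → StaysPositive z (differences as bs))
                  (trans (+-⊖ (suc n) a b) ([1+m]⊖n≡+[1+m∸n] (n + a) b b≤)) stays)
    where b≤ = 0<[1+m]⊖n⇒n≤m (n + a) b (subst (0ℤ ℤ.<_) (+-⊖ (suc n) a b) pos)
  from : ∀ n as bs → Fits n as bs → StaysPositive (+ suc n) (differences as bs)
  from n []       bs       _            = tt
  from n (a ∷ as) []       _            = tt
  from n (a ∷ as) (b ∷ bs) (b≤ , fits) =
    subst (λ z → 0ℤ ℤ.< z × StaysPositive z (differences as bs)) (sym z≡)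
          (ℤ.+<+ (s≤s z≤n) , from (n + a ∸ b) as bs fits)
    where z≡ = trans (+-⊖ (suc n) a b) ([1+m]⊖n≡+[1+m∸n] (n + a) b b≤)

staysPositive-suc∷⇔fits : ∀ n a as bs →
  StaysPositive (+ n) (differences (suc a ∷ as) bs) ⇔ Fits n (a ∷ as) bs
staysPositive-suc∷⇔fits n a as []       = mk⇔ (λ _ → tt) (λ _ → tt)
staysPositive-suc∷⇔fits n a as (b ∷ bs) =
  subst (λ z → (0ℤ ℤ.< z × StaysPositive z (differences as bs)) ⇔ Fits n (a ∷ as) (b ∷ bs))
        shift (staysPositive⇔fits n (a ∷ as) (b ∷ bs))
  where
  shift : + suc n ℤ.+ (+ a ℤ.- + b) ≡ + n ℤ.+ (+ suc a ℤ.- + b)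
  shift = trans (+-⊖ (suc n) a b) (trans (cong (_⊖ b) (sym (ℕₚ.+-suc n a))) (sym (+-⊖ n (suc a) b)))

proposition2 : (k i : ℕ) → 1 < k → 1 ≤ i → i ≤ k →
    (a b : List ℕ) →
    IsComposition (suc k) i a → FirstPartAtLeast2 a →
    IsComposition k i b →
    TOne i a b ⇔ RepresentsTree k (μ a b)
proposition2 k .0 _ () _ (_ ∷ _) [] _ _ (refl , _)
proposition2 k i _ _ _ (suc a ∷ as) (b ∷ bs) (len-a , _ , sum-a) _ (len-b , _ , sum-b) = begin
  TOne i (suc a ∷ as) (b ∷ bs)
    ≈⟨ tOne⇔staysPositive i (suc a ∷ as) (b ∷ bs) len-differences ⟩
  StaysPositive 0ℤ (differences (suc a ∷ as) (b ∷ bs))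
    ≈⟨ staysPositive-suc∷⇔fits 0 a as (b ∷ bs) ⟩
  Fits 0 (a ∷ as) (b ∷ bs)
    ≈⟨ fits⇔height-μ≡just 0 (a ∷ as) (b ∷ bs) ⟩
  (∃ λ m → height 0 w ≡ just m)
    ≈⟨ balanced-height≡just0 w (trans zeros≡k (sym ones≡k)) ⟩
  height 0 w ≡ just 0
    ≈⟨ height≡just0⇔dfsF w ⟩
  (∃ λ ts → w ≡ dfsF ts)
    ≈⟨ representsTree⇔dfsF w zeros≡k ⟨
  RepresentsTree k (b0 ∷ w)
    ∎
  where
  open ⇔-Reasoning
  w = μ (a ∷ as) (b ∷ bs)
  len-a≡len-b : length (a ∷ as) ≡ length (b ∷ bs)
  len-a≡len-b = trans len-a (sym len-b)
  len-differences : length (differences (suc a ∷ as) (b ∷ bs)) ≡ i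
  len-differences =
    trans (length-zipWith _ (suc a ∷ as) (b ∷ bs)) (trans (cong₂ _⊓_ len-a len-b) (ℕₚ.⊓-idem i))
  zeros≡k : zeros w ≡ k
  zeros≡k = trans (zeros-μ (a ∷ as) (b ∷ bs) len-a≡len-b) (ℕₚ.suc-injective sum-a)
  ones≡k : ones w ≡ k
  ones≡k = trans (ones-μ (a ∷ as) (b ∷ bs) len-a≡len-b) sum-b
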